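{- Let $K$ be an infinite field and $n\le r$ integers with $r\le 3n/2$. Suppose $V\in M_{r,r-n}(K)$ has three pairwise disjoint sets $I,J,L\subseteq\{1,\ldots,r\}$, each of size $r-n$, such that $V_I,V_J,V_L$ are invertible. Then there exist diagonal matrices $D_1,D_2\in M_r(K)$ such that the block matrix $(D_2V\,|\,D_1V\,|\,V)\in M_{r,3(r-n)}(K)$ has full column rank.
   Context: For a matrix $A$ with $r$ rows and $I\subseteq\{1,\ldots,r\}$, $A_I$ denotes the submatrix formed by the rows of $A$ indexed by $I$. -}

module Defs where

open import Level using (Level; _⊔_)
open import Data.Nat using (ℕ; zero; suc) renaming (_+_ to _+ℕ_)
open import Data.Fin using (Fin; zero; suc; splitAt; _<_)
open import Data.Sum using (inj₁; inj₂)
open import Data.Product using (Σ; _×_; ∃)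
open import Relation.Nullary using (¬_)
open import Relation.Binary.PropositionalEquality using (_≡_; _≢_)
open import Algebra.Bundles using (CommutativeRing)

record Field (c ℓ : Level) : Set (Level.suc (c ⊔ ℓ)) where
  field
    commutativeRing : CommutativeRing c ℓ
  open CommutativeRing commutativeRing public
  field
    1≉0     : ¬ (1# ≈ 0#)
    inverse : ∀ x → ¬ (x ≈ 0#) → Σ Carrier (λ y → x * y ≈ 1#)

module FieldDefs {c ℓ : Level} (K : Field c ℓ) where
  open Field K using (Carrier; _≈_; _+_; _*_; 0#; 1#)

  Infinite : Set (c ⊔ ℓ)
  Infinite = Σ (ℕ → Carrier) (λ f → ∀ m n → f m ≈ f n → m ≡ n)

  Matrix : ℕ → ℕ → Set c
  Matrix m n = Fin m → Fin n → Carrier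

  ∑ : ∀ {n} → (Fin n → Carrier) → Carrier
  ∑ {zero}  f = 0#
  ∑ {suc n} f = f zero + ∑ (λ i → f (suc i))

  _⊗_ : ∀ {m n p} → Matrix m n → Matrix n p → Matrix m p
  (A ⊗ B) i k = ∑ (λ j → A i j * B j k)

  identity : ∀ {n} → Matrix n n
  identity i j with i Data.Fin.≟ j
  ... | Relation.Nullary.yes _ = 1#
  ... | Relation.Nullary.no  _ = 0#

  _≈ₘ_ : ∀ {m n} → Matrix m n → Matrix m n → Set ℓ
  A ≈ₘ B = ∀ i j → A i j ≈ B i j

  Invertible : ∀ {n} → Matrix n n → Set (c ⊔ ℓ)
  Invertible {n} A = Σ (Matrix n n) (λ B → ((A ⊗ B) ≈ₘ identity) × ((B ⊗ A) ≈ₘ identity))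

  IsDiagonal : ∀ {n} → Matrix n n → Set ℓ
  IsDiagonal D = ∀ i j → i ≢ j → D i j ≈ 0#

  FullColumnRank : ∀ {m n} → Matrix m n → Set (c ⊔ ℓ)
  FullColumnRank {m} {n} A =
    (x : Fin n → Carrier) → (∀ i → ∑ (λ j → A i j * x j) ≈ 0#) → ∀ j → x j ≈ 0#

  -- A_I : rows of A indexed by I, where I is given as a strictly increasing
  -- enumeration Fin k → Fin m of the index set
  rows : ∀ {m n k} → Matrix m n → (Fin k → Fin m) → Matrix k n
  rows A I a j = A (I a) j

  block3 : ∀ {m p q s} → Matrix m p → Matrix m q → Matrix m s → Matrix m (p +ℕ (q +ℕ s))
  block3 {p = p} {q} A B C i j with splitAt p j
  ... | inj₁ a = A i a
  ... | inj₂ b with splitAt q b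
  ...   | inj₁ b' = B i b'
  ...   | inj₂ c' = C i c'

StrictlyIncreasing : ∀ {k r} → (Fin k → Fin r) → Set
StrictlyIncreasing I = ∀ a b → a < b → I a < I b

Disjoint : ∀ {k r} → (Fin k → Fin r) → (Fin k → Fin r) → Set
Disjoint I J = ∀ a b → I a ≢ J b

module Submission where

-- Take D₂ and D₁ to be the diagonal 0/1 matrices selecting the rows in I and in J.
-- For x = (x₁, x₂, x₃) in the kernel of (D₂V | D₁V | V), row i reads
-- [i ∈ I] (V x₁)ᵢ + [i ∈ J] (V x₂)ᵢ + (V x₃)ᵢ = 0. By disjointness the rows in L
-- say V_L x₃ = 0, so x₃ = 0; then the rows in J say V_J x₂ = 0, and the rows in I
-- finally say V_I x₁ = 0.

open import Defs
open import Level using (Level)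
open import Data.Nat as Nat using (ℕ; zero; suc) renaming (_+_ to _+ℕ_)
open import Data.Fin using (Fin; zero; suc; splitAt; _↑ˡ_; _↑ʳ_; _≟_)
open import Data.Fin.Properties using (splitAt-↑ˡ; splitAt-↑ʳ; splitAt⁻¹-↑ˡ; splitAt⁻¹-↑ʳ; any?; suc-injective)
open import Data.Product using (Σ; _×_; _,_)
open import Data.Sum using (inj₁; inj₂)
open import Data.Empty using (⊥-elim)
open import Function using (_∘_)
open import Relation.Nullary using (yes; no)
open import Relation.Binary.PropositionalEquality using (_≡_; _≢_; cong; subst) renaming (refl to ≡-refl; sym to ≡-sym; trans to ≡-trans)
import Algebra.Properties.CommutativeSemigroup as CommutativeSemigroupProperties
import Relation.Binary.Reasoning.Setoid as SetoidReasoning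

module FieldMatrices {c ℓ : Level} (K : Field c ℓ) where
  open Field K hiding (zero)
  open FieldDefs K
  open SetoidReasoning setoid

  Vector : ℕ → Set c
  Vector n = Fin n → Carrier

  ∑-cong : ∀ {n} {f g : Vector n} → (∀ i → f i ≈ g i) → ∑ f ≈ ∑ g
  ∑-cong {zero}  f≈g = refl
  ∑-cong {suc n} f≈g = +-cong (f≈g zero) (∑-cong (f≈g ∘ suc))

  ∑-zero : ∀ {n} {f : Vector n} → (∀ i → f i ≈ 0#) → ∑ f ≈ 0#
  ∑-zero {zero}  f≈0 = refl
  ∑-zero {suc n} f≈0 = trans (+-cong (f≈0 zero) (∑-zero (f≈0 ∘ suc))) (+-identityˡ 0#)

  ∑-distrib-+ : ∀ {n} (f g : Vector n) → ∑ (λ i → f i + g i) ≈ ∑ f + ∑ g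
  ∑-distrib-+ {zero}  f g = sym (+-identityˡ 0#)
  ∑-distrib-+ {suc n} f g =
    trans (+-congˡ (∑-distrib-+ (f ∘ suc) (g ∘ suc)))
          (CommutativeSemigroupProperties.interchange +-commutativeSemigroup _ _ _ _)

  *-distribˡ-∑ : ∀ {n} a (f : Vector n) → a * ∑ f ≈ ∑ (λ i → a * f i)
  *-distribˡ-∑ {zero}  a f = zeroʳ a
  *-distribˡ-∑ {suc n} a f = trans (distribˡ a _ _) (+-congˡ (*-distribˡ-∑ a (f ∘ suc)))

  *-distribʳ-∑ : ∀ {n} a (f : Vector n) → ∑ f * a ≈ ∑ (λ i → f i * a)
  *-distribʳ-∑ {zero}  a f = zeroˡ a
  *-distribʳ-∑ {suc n} a f = trans (distribʳ a _ _) (+-congˡ (*-distribʳ-∑ a (f ∘ suc)))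

  ∑-comm : ∀ {m n} (f : Fin m → Fin n → Carrier) →
           ∑ (λ i → ∑ (λ j → f i j)) ≈ ∑ (λ j → ∑ (λ i → f i j))
  ∑-comm {zero} {n} f = sym (∑-zero {n} (λ _ → refl))
  ∑-comm {suc m} f =
    trans (+-congˡ (∑-comm (f ∘ suc))) (sym (∑-distrib-+ (f zero) _))

  ∑-single : ∀ {n} (f : Vector n) i → (∀ j → j ≢ i → f j ≈ 0#) → ∑ f ≈ f i
  ∑-single f zero    f≈0 = trans (+-congˡ (∑-zero (λ j → f≈0 (suc j) (λ ())))) (+-identityʳ _)
  ∑-single f (suc i) f≈0 = trans (+-cong (f≈0 zero (λ ())) (∑-single (f ∘ suc) i f∘suc≈0)) (+-identityˡ _)
    where
    f∘suc≈0 : ∀ j → j ≢ i → f (suc j) ≈ 0#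
    f∘suc≈0 j j≢i = f≈0 (suc j) (j≢i ∘ suc-injective)

  ∑-splitAt : ∀ {p q} (f : Vector (p +ℕ q)) → ∑ f ≈ ∑ (f ∘ (_↑ˡ q)) + ∑ (f ∘ (p ↑ʳ_))
  ∑-splitAt {zero}  f = sym (+-identityˡ _)
  ∑-splitAt {suc p} {q} f = trans (+-congˡ (∑-splitAt {p} {q} (f ∘ suc))) (sym (+-assoc _ _ _))

  infixr 7 _·_

  _·_ : ∀ {m n} → Matrix m n → Vector n → Vector m
  (A · x) i = ∑ (λ j → A i j * x j)

  ·-zero : ∀ {m n} (A : Matrix m n) {x : Vector n} → (∀ j → x j ≈ 0#) → ∀ i → (A · x) i ≈ 0#
  ·-zero A x≈0 i = ∑-zero (λ j → trans (*-congˡ (x≈0 j)) (zeroʳ _))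

  ⊗-· : ∀ {m n p} (A : Matrix m n) (B : Matrix n p) x i → ((A ⊗ B) · x) i ≈ (A · (B · x)) i
  ⊗-· {n = n} {p} A B x i = begin
    ∑ (λ k → ∑ (λ j → A i j * B j k) * x k)  ≈⟨ ∑-cong {p} (λ k → *-distribʳ-∑ (x k) (λ j → A i j * B j k)) ⟩
    ∑ (λ k → ∑ (λ j → A i j * B j k * x k))  ≈⟨ ∑-comm (λ j k → A i j * B j k * x k) ⟨
    ∑ (λ j → ∑ (λ k → A i j * B j k * x k))  ≈⟨ ∑-cong {n} (λ j → ∑-cong {p} (λ k → *-assoc _ _ _)) ⟩
    ∑ (λ j → ∑ (λ k → A i j * (B j k * x k))) ≈⟨ ∑-cong {n} (λ j → *-distribˡ-∑ (A i j) (λ k → B j k * x k)) ⟨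
    ∑ (λ j → A i j * (B · x) j)               ∎

  identity-diagonal : ∀ {n} (i : Fin n) → identity i i ≈ 1#
  identity-diagonal i with i ≟ i
  ... | yes _  = refl
  ... | no i≢i = ⊥-elim (i≢i ≡-refl)

  identity-offDiagonal : ∀ {n} {i j : Fin n} → i ≢ j → identity i j ≈ 0#
  identity-offDiagonal {i = i} {j} i≢j with i ≟ j
  ... | yes i≡j = ⊥-elim (i≢j i≡j)
  ... | no _    = refl

  ∑-identity : ∀ {n} (i : Fin n) (f : Vector n) → ∑ (λ j → identity i j * f j) ≈ f i
  ∑-identity i f = begin
    ∑ (λ j → identity i j * f j) ≈⟨ ∑-single _ i off-i ⟩
    identity i i * f i           ≈⟨ *-congʳ (identity-diagonal i) ⟩
    1# * f i                     ≈⟨ *-identityˡ _ ⟩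
    f i                          ∎
    where
    off-i : ∀ j → j ≢ i → identity i j * f j ≈ 0#
    off-i j j≢i = trans (*-congʳ (identity-offDiagonal (j≢i ∘ ≡-sym))) (zeroˡ _)

  Invertible⇒FullColumnRank : ∀ {n} {A : Matrix n n} → Invertible A → FullColumnRank A
  Invertible⇒FullColumnRank {A = A} (B , _ , BA≈1) x Ax≈0 j = begin
    x j                ≈⟨ ∑-identity j x ⟨
    (identity · x) j   ≈⟨ ∑-cong (λ k → *-congʳ (BA≈1 j k)) ⟨
    ((B ⊗ A) · x) j    ≈⟨ ⊗-· B A x j ⟩
    (B · (A · x)) j    ≈⟨ ·-zero B Ax≈0 j ⟩
    0#                 ∎

  diagonal : ∀ {n} → Vector n → Matrix n n
  diagonal d i j = identity i j * d i

  diagonal-isDiagonal : ∀ {n} (d : Vector n) → IsDiagonal (diagonal d)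
  diagonal-isDiagonal d i j i≢j = trans (*-congʳ (identity-offDiagonal i≢j)) (zeroˡ _)

  diagonal-· : ∀ {n} (d x : Vector n) i → (diagonal d · x) i ≈ d i * x i
  diagonal-· {n} d x i = trans (∑-cong {n} (λ j → *-assoc _ _ _)) (∑-identity i (λ j → d i * x j))

  diagonal-⊗-· : ∀ {m n} (d : Vector m) (V : Matrix m n) x i → ((diagonal d ⊗ V) · x) i ≈ d i * (V · x) i
  diagonal-⊗-· d V x i = trans (⊗-· (diagonal d) V x i) (diagonal-· d (V · x) i)

  module _ {p q s : ℕ} (x : Vector (p +ℕ (q +ℕ s))) where
    firstBlock : Vector p
    firstBlock a = x (a ↑ˡ (q +ℕ s))

    secondBlock : Vector q
    secondBlock b = x (p ↑ʳ (b ↑ˡ s))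

    thirdBlock : Vector s
    thirdBlock c = x (p ↑ʳ (q ↑ʳ c))

    ≈0-at : ∀ {j j′} → j ≡ j′ → x j ≈ 0# → x j′ ≈ 0#
    ≈0-at = subst (λ t → x t ≈ 0#)

    blocks≈0⇒≈0 : (∀ a → firstBlock a ≈ 0#) → (∀ b → secondBlock b ≈ 0#) → (∀ c → thirdBlock c ≈ 0#) →
                  ∀ j → x j ≈ 0#
    blocks≈0⇒≈0 x₁≈0 x₂≈0 x₃≈0 j with splitAt p j in j≡
    ... | inj₁ a = ≈0-at (splitAt⁻¹-↑ˡ j≡) (x₁≈0 a)
    ... | inj₂ k with splitAt q k in k≡
    ...   | inj₁ b = ≈0-at (≡-trans (cong (p ↑ʳ_) (splitAt⁻¹-↑ˡ k≡)) (splitAt⁻¹-↑ʳ j≡)) (x₂≈0 b)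
    ...   | inj₂ c = ≈0-at (≡-trans (cong (p ↑ʳ_) (splitAt⁻¹-↑ʳ k≡)) (splitAt⁻¹-↑ʳ j≡)) (x₃≈0 c)

  module _ {m p q s : ℕ} (A : Matrix m p) (B : Matrix m q) (C : Matrix m s) (i : Fin m) where
    block3-↑ˡ : ∀ a → block3 A B C i (a ↑ˡ (q +ℕ s)) ≡ A i a
    block3-↑ˡ a rewrite splitAt-↑ˡ p a (q +ℕ s) = ≡-refl

    block3-↑ʳ↑ˡ : ∀ b → block3 A B C i (p ↑ʳ (b ↑ˡ s)) ≡ B i b
    block3-↑ʳ↑ˡ b rewrite splitAt-↑ʳ p (q +ℕ s) (b ↑ˡ s) | splitAt-↑ˡ q b s = ≡-refl

    block3-↑ʳ↑ʳ : ∀ c → block3 A B C i (p ↑ʳ (q ↑ʳ c)) ≡ C i c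
    block3-↑ʳ↑ʳ c rewrite splitAt-↑ʳ p (q +ℕ s) (q ↑ʳ c) | splitAt-↑ʳ q s c = ≡-refl

    block3-· : ∀ x → (block3 A B C · x) i ≈
               (A · firstBlock {p} {q} {s} x) i + ((B · secondBlock {p} {q} {s} x) i + (C · thirdBlock {p} {q} {s} x) i)
    block3-· x = begin
      ∑ (λ j → M j * x j)
        ≈⟨ ∑-splitAt {p} (λ j → M j * x j) ⟩
      ∑ (λ a → M (a ↑ˡ (q +ℕ s)) * x₁ a) + ∑ (λ j → M (p ↑ʳ j) * x (p ↑ʳ j))
        ≈⟨ +-congˡ (∑-splitAt {q} (λ j → M (p ↑ʳ j) * x (p ↑ʳ j))) ⟩
      ∑ (λ a → M (a ↑ˡ (q +ℕ s)) * x₁ a)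
        + (∑ (λ b → M (p ↑ʳ (b ↑ˡ s)) * x₂ b) + ∑ (λ c → M (p ↑ʳ (q ↑ʳ c)) * x₃ c))
        ≈⟨ +-cong (∑-cong (λ a → *-congʳ (reflexive (block3-↑ˡ a))))
                  (+-cong (∑-cong (λ b → *-congʳ (reflexive (block3-↑ʳ↑ˡ b))))
                          (∑-cong (λ c → *-congʳ (reflexive (block3-↑ʳ↑ʳ c))))) ⟩
      (A · x₁) i + ((B · x₂) i + (C · x₃) i) ∎
      where
      M : Vector (p +ℕ (q +ℕ s))
      M = block3 A B C i
      x₁ : Vector p
      x₁ = firstBlock {p} {q} {s} x
      x₂ : Vector q
      x₂ = secondBlock {p} {q} {s} x
      x₃ : Vector s
      x₃ = thirdBlock {p} {q} {s} x

  indicator : ∀ {k n} → (Fin k → Fin n) → Vector n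
  indicator I i with any? (λ a → I a ≟ i)
  ... | yes _ = 1#
  ... | no  _ = 0#

  indicator-image : ∀ {k n} (I : Fin k → Fin n) a y → indicator I (I a) * y ≈ y
  indicator-image I a y with any? (λ a′ → I a′ ≟ I a)
  ... | yes _ = *-identityˡ y
  ... | no ∉I = ⊥-elim (∉I (a , ≡-refl))

  indicator-outside : ∀ {k n} (I : Fin k → Fin n) {i} → (∀ a → I a ≢ i) → ∀ y → indicator I i * y ≈ 0#
  indicator-outside I {i} ∉I y with any? (λ a → I a ≟ i)
  ... | yes (a , Ia≡i) = ⊥-elim (∉I a Ia≡i)
  ... | no _           = zeroˡ y

  staircase-fullColumnRank : ∀ {k n} {V : Matrix n k} {I J L : Fin k → Fin n} →
    Disjoint I J → Disjoint I L → Disjoint J L →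
    FullColumnRank (rows V I) → FullColumnRank (rows V J) → FullColumnRank (rows V L) →
    FullColumnRank (block3 (diagonal (indicator I) ⊗ V) (diagonal (indicator J) ⊗ V) V)
  staircase-fullColumnRank {k} {n} {V} {I} {J} {L} I∩J=∅ I∩L=∅ J∩L=∅ V_I V_J V_L x Mx≈0 =
    blocks≈0⇒≈0 x x₁≈0 x₂≈0 x₃≈0
    where
    x₁ x₂ x₃ : Vector k
    x₁ = firstBlock {k} {k} {k} x
    x₂ = secondBlock {k} {k} {k} x
    x₃ = thirdBlock {k} {k} {k} x

    D₂V D₁V : Matrix n k
    D₂V = diagonal (indicator I) ⊗ V
    D₁V = diagonal (indicator J) ⊗ V

    row : ∀ i {u v w} → indicator I i * (V · x₁) i ≈ u → indicator J i * (V · x₂) i ≈ v → (V · x₃) i ≈ w →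
          u + (v + w) ≈ 0#
    row i {u} {v} {w} ≈u ≈v ≈w = begin
      u + (v + w)
        ≈⟨ +-cong ≈u (+-cong ≈v ≈w) ⟨
      indicator I i * (V · x₁) i + (indicator J i * (V · x₂) i + (V · x₃) i)
        ≈⟨ +-cong (diagonal-⊗-· (indicator I) V x₁ i) (+-congʳ (diagonal-⊗-· (indicator J) V x₂ i)) ⟨
      (D₂V · x₁) i + ((D₁V · x₂) i + (V · x₃) i)
        ≈⟨ block3-· D₂V D₁V V i x ⟨
      (block3 D₂V D₁V V · x) i
        ≈⟨ Mx≈0 i ⟩
      0# ∎

    x₃≈0 : ∀ c → x₃ c ≈ 0#
    x₃≈0 = V_L x₃ λ c → trans (sym (trans (+-identityˡ _) (+-identityˡ _)))
      (row (L c) (indicator-outside I (λ a → I∩L=∅ a c) _) (indicator-outside J (λ b → J∩L=∅ b c) _) refl)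

    x₂≈0 : ∀ b → x₂ b ≈ 0#
    x₂≈0 = V_J x₂ λ b → trans (sym (trans (+-identityˡ _) (+-identityʳ _)))
      (row (J b) (indicator-outside I (λ a → I∩J=∅ a b) _) (indicator-image J b _) (·-zero V x₃≈0 (J b)))

    x₁≈0 : ∀ a → x₁ a ≈ 0#
    x₁≈0 = V_I x₁ λ a → trans (sym (trans (+-congˡ (+-identityʳ _)) (+-identityʳ _)))
      (row (I a) (indicator-image I a _) (indicator-outside J (λ b → I∩J=∅ a b ∘ ≡-sym) _) (·-zero V x₃≈0 (I a)))

open Nat using (_≤_; _*_; _∸_)

corollary2 : ∀ {c ℓ : Level} (K : Field c ℓ) → FieldDefs.Infinite K →
    (n r : ℕ) → n ≤ r → 2 * r ≤ 3 * n →
    (V : FieldDefs.Matrix K r (r ∸ n)) →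
    (I J L : Fin (r ∸ n) → Fin r) →
    StrictlyIncreasing I → StrictlyIncreasing J → StrictlyIncreasing L →
    Disjoint I J → Disjoint I L → Disjoint J L →
    FieldDefs.Invertible K (FieldDefs.rows K V I) →
    FieldDefs.Invertible K (FieldDefs.rows K V J) →
    FieldDefs.Invertible K (FieldDefs.rows K V L) →
    Σ (FieldDefs.Matrix K r r) (λ D₁ → Σ (FieldDefs.Matrix K r r) (λ D₂ →
      FieldDefs.IsDiagonal K D₁ × FieldDefs.IsDiagonal K D₂ ×
      FieldDefs.FullColumnRank K
        (FieldDefs.block3 K (FieldDefs._⊗_ K D₂ V) (FieldDefs._⊗_ K D₁ V) V)))
corollary2 K _ n r _ _ V I J L _ _ _ I∩J=∅ I∩L=∅ J∩L=∅ V_I V_J V_L =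
  diagonal (indicator J) , diagonal (indicator I) ,
  diagonal-isDiagonal (indicator J) , diagonal-isDiagonal (indicator I) ,
  staircase-fullColumnRank I∩J=∅ I∩L=∅ J∩L=∅
    (Invertible⇒FullColumnRank V_I) (Invertible⇒FullColumnRank V_J) (Invertible⇒FullColumnRank V_L)
  where open FieldMatrices K
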